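{- Let $k\geq 1$. Let $\mathcal{A}=(a_1,a_2,\ldots,a_k)_{\bar r}$ be a finite sequence of integers, where $0<a_1<a_2<\cdots<a_k$ and $\bar r=(r_1,\ldots,r_k)$ with $r_i\geq 1$ for all $i$. Let $0\leq\alpha\leq \sum_{i=1}^k r_i-1$. Then there exists an integer $m\in[1,k]$ with $\sum_{i=1}^{m-1} r_i\leq \alpha<\sum_{i=1}^m r_i$, and \[|\Sigma_{\alpha}(\bar r,\mathcal{A})|\geq \sum_{i=1}^k i r_i-\sum_{i=1}^m i r_i+m\left(\sum_{i=1}^m r_i-\alpha\right)+1.\] Moreover, this lower bound is best possible, i.e., for given $k,\bar r,\alpha$ it is attained by some such sequence.
   Context: For distinct integers $a_1,\ldots,a_k$ and $\bar r=(r_1,\ldots,r_k)$ with $r_i\geq 1$, $(a_1,\ldots,a_k)_{\bar r}$ denotes the finite sequence consisting of $r_i$ copies of $a_i$ for each $i$. For such a sequence $\mathcal{A}$ and an integer $0\leq\alpha\leq\sum_i r_i$, $\Sigma_{\alpha}(\bar r,\mathcal{A})$ is the set of sums $s(\mathcal{B})$ of all terms of $\mathcal{B}$, over all subsequences $\mathcal{B}$ of $\mathcal{A}$ of length at least $\alpha$ (the empty subsequence has sum $0$). For integers $a\leq b$, $[a,b]=\{a,\ldots,b\}$; empty sums are $0$. -}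

module Defs where

open import Data.Nat using (ℕ; zero; suc; _+_; _*_; _≤_; _<_)
open import Data.Fin using (Fin; toℕ)
open import Data.Nat.ListAction using (sum)
open import Data.Nat using (_<ᵇ_)
open import Data.Bool using (if_then_else_)
open import Data.List using (List; length; concat; map; replicate; allFin)
open import Data.List.Relation.Binary.Sublist.Propositional using (_⊆_)
open import Data.List.Relation.Unary.All using (All)
open import Data.List.Relation.Unary.Unique.Propositional using (Unique)
open import Data.List.Membership.Propositional using (_∈_)
open import Data.Product using (Σ; ∃; _×_)
open import Relation.Binary.PropositionalEquality using (_≡_)

-- (a₁,…,a_k)_r̄ : r i copies of a i, listed for i = 1,…,k in order
-- (index i : Fin k corresponds to the paper's index toℕ i + 1)
seqOf : (k : ℕ) → (Fin k → ℕ) → (Fin k → ℕ) → List ℕ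
seqOf k a r = concat (map (λ i → replicate (r i) (a i)) (allFin k))

-- Σ_α(r̄, 𝒜) as a predicate on ℕ: sums of subsequences of length ≥ α
InSigma : ℕ → List ℕ → ℕ → Set
InSigma α A s = Σ (List ℕ) λ B → B ⊆ A × α ≤ length B × sum B ≡ s

-- ∑_{i=1}^{m} f_i  (paper indexing), i.e. sum of f i over toℕ i < m
psum : {k : ℕ} → (Fin k → ℕ) → ℕ → ℕ
psum {k} f m = sum (map (λ i → if toℕ i <ᵇ m then f i else 0) (allFin k))

weighted : {k : ℕ} → (Fin k → ℕ) → Fin k → ℕ
weighted r i = suc (toℕ i) * r i

AtLeast : (ℕ → Set) → ℕ → Set
AtLeast P n = Σ (List ℕ) λ xs → Unique xs × All P xs × n ≤ length xs

Exactly : (ℕ → Set) → ℕ → Set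
Exactly P n = Σ (List ℕ) λ xs → Unique xs × All P xs × (∀ x → P x → x ∈ xs) × length xs ≡ n

Admissible : (k : ℕ) → (Fin k → ℕ) → Set
Admissible k a = (∀ i → 0 < a i) × (∀ i j → toℕ i < toℕ j → a i < a j)

module Submission where

-- Write L = (a₁,…,a_k)_r̄ in increasing order and build the subsequence sums by
-- appending the entries of L one at a time, starting from the prefix P of the
-- first α entries, whose own sum is the first element of Σ_α.  When an entry x of
-- block i is appended to a prefix P, every v ∈ {0, a₁, …, a_{i-1}} can be removed
-- from P ++ [x], giving i distinct sums sum P + x − v, all larger than sum P and
-- hence new.  Summing these gains over the entries after position α gives
-- 1 + Σ_{entries after α} (block index), which the block arithmetic of [tailSum]
-- identifies with the bound of the theorem, m being the block containing the
-- (α+1)-st entry ([locateBlock]).  For a_i = i the removable values are all of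
-- 0, 1, …, x−1, so each step covers a whole interval; then Σ_α is exactly the
-- integer interval [sum of the α smallest entries, sum L], of the same size.

open import Defs
open import Data.Nat using (ℕ; zero; suc; _+_; _*_; _∸_; _≤_; _<_; z≤n; s≤s; s≤s⁻¹; _<ᵇ_; _<?_; _≤?_)
open import Data.Nat.Properties
open import Data.Nat.ListAction using (sum)
open import Data.Nat.ListAction.Properties using (sum-++)
open import Data.Bool using (if_then_else_)
open import Data.Fin using (Fin; toℕ; inject; fromℕ<) renaming (zero to fz; suc to fs)
open import Data.Fin.Properties using (toℕ-injective; toℕ-inject; toℕ<n; toℕ-fromℕ<)
open import Data.List using (List; tabulate; applyUpTo; []; _∷_; length; concat; map; replicate; allFin; drop; take; _++_)
open import Data.List.Properties using (map-tabulate; length-++; length-replicate; length-map; length-tabulate; length-take; length-applyUpTo; take++drop≡id; ++-assoc; ++-identityʳ)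
open import Data.Product using (Σ; _×_; _,_)
open import Data.Sum using (_⊎_; inj₁; inj₂)
open import Data.Unit using (⊤; tt)
open import Data.Empty using (⊥; ⊥-elim)
open import Data.List.Relation.Binary.Sublist.Propositional using (_⊆_; []; _∷_; _∷ʳ_; ⊆-refl; ⊆-trans)
open import Data.List.Relation.Binary.Sublist.Propositional.Properties using (++⁺; ++⁺ʳ; length-mono-≤)
open import Data.List.Relation.Unary.All using (All; []; _∷_; lookup) renaming (map to all-map; zipWith to all-zipWith)
open import Data.List.Relation.Unary.All.Properties using () renaming (++⁺ to all-++⁺; map⁺ to all-map⁺; tabulate⁺ to all-tabulate⁺; replicate⁺ to all-replicate⁺; applyUpTo⁺₁ to all-applyUpTo⁺₁)
open import Data.List.Relation.Unary.Any using (here; there)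
open import Data.List.Relation.Unary.AllPairs using (AllPairs; []; _∷_)
open import Data.List.Relation.Unary.AllPairs.Properties using () renaming (concat⁺ to allPairs-concat⁺; tabulate⁺-< to allPairs-tabulate⁺)
open import Data.List.Relation.Unary.Unique.Propositional using (Unique)
open import Data.List.Relation.Unary.Unique.Propositional.Properties using () renaming (++⁺ to unique-++⁺; tabulate⁺ to unique-tabulate⁺; applyUpTo⁺₁ to unique-applyUpTo⁺₁)
open import Data.List.Membership.Propositional using (_∈_)
open import Data.List.Relation.Binary.Subset.Propositional using () renaming (_⊆_ to _⊆ₘ_)
open import Data.List.Membership.Propositional.Properties using (∈-++⁺ˡ; ∈-++⁺ʳ; ∈-applyUpTo⁺)
open import Function using (_∘_; id)
open import Relation.Nullary using (¬_; yes; no)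
open import Relation.Binary using (tri<; tri≈; tri>)
open import Relation.Binary.PropositionalEquality
open ≡-Reasoning

map-allFin-suc : ∀ {A : Set} {k} (f : Fin (suc k) → A) →
  map f (allFin (suc k)) ≡ f fz ∷ map (f ∘ fs) (allFin k)
map-allFin-suc {k = k} f =
  cong (f fz ∷_) (trans (map-tabulate fs f) (sym (map-tabulate id (f ∘ fs))))

seqOf-suc : ∀ k (a r : Fin (suc k) → ℕ) →
  seqOf (suc k) a r ≡ replicate (r fz) (a fz) ++ seqOf k (a ∘ fs) (r ∘ fs)
seqOf-suc k a r = cong concat (map-allFin-suc (λ i → replicate (r i) (a i)))

psum-suc : ∀ k (f : Fin (suc k) → ℕ) m → psum f (suc m) ≡ f fz + psum (f ∘ fs) m
psum-suc k f m = cong sum (map-allFin-suc (λ i → if toℕ i <ᵇ suc m then f i else 0))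

psum-zero : ∀ k (f : Fin k → ℕ) → psum f 0 ≡ 0
psum-zero zero    f = refl
psum-zero (suc k) f =
  trans (cong sum (map-allFin-suc (λ i → if toℕ i <ᵇ 0 then f i else 0))) (psum-zero k (f ∘ fs))

psum-one : ∀ k (f : Fin (suc k) → ℕ) → psum f 1 ≡ f fz
psum-one k f = trans (psum-suc k f 0) (trans (cong (f fz +_) (psum-zero k (f ∘ fs))) (+-identityʳ (f fz)))

sum-replicate : ∀ n x → sum (replicate n x) ≡ n * x
sum-replicate zero    x = refl
sum-replicate (suc n) x = cong (x +_) (sum-replicate n x)

length-seqOf : ∀ k (a r : Fin k → ℕ) → length (seqOf k a r) ≡ psum r k
length-seqOf zero    a r = refl
length-seqOf (suc k) a r = begin
  length (seqOf (suc k) a r)                       ≡⟨ cong length (seqOf-suc k a r) ⟩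
  length (replicate (r fz) (a fz) ++ rest)         ≡⟨ length-++ (replicate (r fz) (a fz)) ⟩
  length (replicate (r fz) (a fz)) + length rest   ≡⟨ cong₂ _+_ (length-replicate (r fz)) (length-seqOf k (a ∘ fs) (r ∘ fs)) ⟩
  r fz + psum (r ∘ fs) k                           ≡⟨ psum-suc k r k ⟨
  psum r (suc k)                                   ∎
  where rest = seqOf k (a ∘ fs) (r ∘ fs)

sum-seqOf : ∀ k (a r : Fin k → ℕ) → sum (seqOf k a r) ≡ psum (λ i → a i * r i) k
sum-seqOf zero    a r = refl
sum-seqOf (suc k) a r = begin
  sum (seqOf (suc k) a r)                          ≡⟨ cong sum (seqOf-suc k a r) ⟩
  sum (replicate (r fz) (a fz) ++ rest)            ≡⟨ sum-++ (replicate (r fz) (a fz)) rest ⟩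
  sum (replicate (r fz) (a fz)) + sum rest         ≡⟨ cong₂ _+_ (trans (sum-replicate (r fz) (a fz)) (*-comm (r fz) (a fz))) (sum-seqOf k (a ∘ fs) (r ∘ fs)) ⟩
  a fz * r fz + psum (λ i → a (fs i) * r (fs i)) k ≡⟨ psum-suc k (λ i → a i * r i) k ⟨
  psum (λ i → a i * r i) (suc k)                   ∎
  where rest = seqOf k (a ∘ fs) (r ∘ fs)

-- m is the (paper-indexed) block containing the (α+1)-st entry of the sequence.
BlockOf : (k : ℕ) → (Fin k → ℕ) → ℕ → ℕ → Set
BlockOf k r α m = 1 ≤ m × m ≤ k × psum r (m ∸ 1) ≤ α × α < psum r m

locateBlock : ∀ k (r : Fin k → ℕ) α → α < psum r k → Σ ℕ (BlockOf k r α)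
locateBlock zero    r α ()
locateBlock (suc k) r α α<total with α <? r fz
... | yes α<r₀ = 1 , s≤s z≤n , s≤s z≤n , subst (_≤ α) (sym (psum-zero (suc k) r)) z≤n ,
                  subst (α <_) (sym (psum-one k r)) α<r₀
... | no α≮r₀ with m≤n⇒∃[o]m+o≡n (≮⇒≥ α≮r₀)
...   | β , refl with locateBlock k (r ∘ fs) β (+-cancelˡ-< (r fz) _ _ (subst (r fz + β <_) (psum-suc k r k) α<total))
...     | suc m , _ , m<k , lower , upper =
  suc (suc m) , s≤s z≤n , s≤s m<k ,
  subst (_≤ r fz + β) (sym (psum-suc k r m)) (+-monoʳ-≤ (r fz) lower) ,
  subst (r fz + β <_) (sym (psum-suc k r (suc m))) (+-monoʳ-< (r fz) upper)

drop-within-replicate : ∀ {α n} (x : ℕ) L → α ≤ n →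
  drop α (replicate n x ++ L) ≡ replicate (n ∸ α) x ++ L
drop-within-replicate x L z≤n       = refl
drop-within-replicate x L (s≤s α≤n) = drop-within-replicate x L α≤n

drop-past-replicate : ∀ n β (x : ℕ) L → drop (n + β) (replicate n x ++ L) ≡ drop β L
drop-past-replicate zero    β x L = refl
drop-past-replicate (suc n) β x L = drop-past-replicate n β x L

-- Dropping the first α entries, α in block m, leaves psum r m ∸ α copies of block m
-- and blocks m+1,…,k in full.  For block labels c forming the progression
-- d+1, d+2, … (d is the offset needed for the induction) the remaining sum is:
tailSum : ∀ k (r c : Fin k → ℕ) d → (∀ i → c i ≡ suc (d + toℕ i)) → ∀ α m → BlockOf k r α m →
  sum (drop α (seqOf k c r)) ≡
    (psum (λ i → c i * r i) k ∸ psum (λ i → c i * r i) m) + (d + m) * (psum r m ∸ α)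
tailSum (suc k) r c d c≡ α (suc zero) (_ , _ , _ , α<r₁) = begin
  sum (drop α (seqOf (suc k) c r))                   ≡⟨ cong (sum ∘ drop α) (seqOf-suc k c r) ⟩
  sum (drop α (replicate (r fz) (c fz) ++ rest))     ≡⟨ cong sum (drop-within-replicate (c fz) rest (<⇒≤ α<r₀)) ⟩
  sum (replicate (r fz ∸ α) (c fz) ++ rest)          ≡⟨ sum-++ (replicate (r fz ∸ α) (c fz)) rest ⟩
  sum (replicate (r fz ∸ α) (c fz)) + sum rest       ≡⟨ cong₂ _+_ (sum-replicate (r fz ∸ α) (c fz)) (sum-seqOf k (c ∘ fs) (r ∘ fs)) ⟩
  (r fz ∸ α) * c fz + X                              ≡⟨ +-comm ((r fz ∸ α) * c fz) X ⟩
  X + (r fz ∸ α) * c fz                              ≡⟨ cong₂ _+_ tail (trans (*-comm (r fz ∸ α) (c fz)) (cong₂ _*_ c₀ (cong (_∸ α) (sym (psum-one k r))))) ⟩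
  (psum f (suc k) ∸ psum f 1) + (d + 1) * (psum r 1 ∸ α) ∎
  where
  f : Fin (suc k) → ℕ
  f i = c i * r i
  rest : List ℕ
  rest = seqOf k (c ∘ fs) (r ∘ fs)
  X : ℕ
  X = psum (f ∘ fs) k
  α<r₀ : α < r fz
  α<r₀ = subst (α <_) (psum-one k r) α<r₁
  c₀ : c fz ≡ d + 1
  c₀ = trans (c≡ fz) (sym (+-suc d 0))
  tail : X ≡ psum f (suc k) ∸ psum f 1
  tail = sym (trans (cong₂ _∸_ (psum-suc k f k) (psum-one k f)) (m+n∸m≡n (f fz) X))
tailSum (suc k) r c d c≡ α (suc (suc m)) (_ , s≤s m<k , lower , upper)
  with m≤n⇒∃[o]m+o≡n (≤-trans (m≤m+n (r fz) _) (subst (_≤ α) (psum-suc k r m) lower))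
... | β , refl = begin
  sum (drop (r fz + β) (seqOf (suc k) c r))              ≡⟨ cong (sum ∘ drop (r fz + β)) (seqOf-suc k c r) ⟩
  sum (drop (r fz + β) (replicate (r fz) (c fz) ++ rest)) ≡⟨ cong sum (drop-past-replicate (r fz) β (c fz) rest) ⟩
  sum (drop β rest)                                       ≡⟨ tailSum k (r ∘ fs) (c ∘ fs) (suc d) c≡′ β (suc m) block′ ⟩
  (psum (f ∘ fs) k ∸ psum (f ∘ fs) (suc m)) + (suc d + suc m) * (psum (r ∘ fs) (suc m) ∸ β)
    ≡⟨ cong₂ _+_ (sym (trans (cong₂ _∸_ (psum-suc k f k) (psum-suc k f (suc m))) ([m+n]∸[m+o]≡n∸o (f fz) _ _)))
                 (cong₂ _*_ (sym (+-suc d (suc m))) (sym (trans (cong (_∸ (r fz + β)) (psum-suc k r (suc m))) ([m+n]∸[m+o]≡n∸o (r fz) _ _)))) ⟩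
  (psum f (suc k) ∸ psum f (suc (suc m))) + (d + suc (suc m)) * (psum r (suc (suc m)) ∸ (r fz + β)) ∎
  where
  f : Fin (suc k) → ℕ
  f i = c i * r i
  rest : List ℕ
  rest = seqOf k (c ∘ fs) (r ∘ fs)
  c≡′ : ∀ i → c (fs i) ≡ suc (suc d + toℕ i)
  c≡′ i = trans (c≡ (fs i)) (cong suc (+-suc d (toℕ i)))
  block′ : BlockOf k (r ∘ fs) β (suc m)
  block′ = s≤s z≤n , m<k ,
           +-cancelˡ-≤ (r fz) _ _ (subst (_≤ r fz + β) (psum-suc k r m) lower) ,
           +-cancelˡ-< (r fz) _ _ (subst (r fz + β <_) (psum-suc k r (suc m)) upper)

sum-mono-⊆ : ∀ {B L : List ℕ} → B ⊆ L → sum B ≤ sum L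
sum-mono-⊆ []                   = z≤n
sum-mono-⊆ {L = y ∷ L} (y ∷ʳ p) = ≤-trans (sum-mono-⊆ p) (m≤n+m (sum L) y)
sum-mono-⊆ (_∷_ {x = x} refl p) = +-monoʳ-≤ x (sum-mono-⊆ p)

InSigma-mono : ∀ {α P Q s} → P ⊆ Q → InSigma α P s → InSigma α Q s
InSigma-mono P⊆Q (B , B⊆P , αB , sumB) = B , ⊆-trans B⊆P P⊆Q , αB , sumB

remove : ∀ {v} (P : List ℕ) → v ∈ P →
  Σ (List ℕ) λ P′ → P′ ⊆ P × length P ≡ suc (length P′) × sum P′ + v ≡ sum P
remove (x ∷ P) (here refl) = P , x ∷ʳ ⊆-refl , refl , +-comm (sum P) x
remove (x ∷ P) (there v∈P) with remove P v∈P
... | P′ , P′⊆P , len , total = x ∷ P′ , refl ∷ P′⊆P , cong suc len , trans (+-assoc x (sum P′) _) (cong (x +_) total)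

-- v can be taken out of P: it is 0 (remove nothing) or an entry of P.
Removable : List ℕ → ℕ → Set
Removable P v = v ≡ 0 ⊎ v ∈ P

sum-snoc : ∀ (P : List ℕ) x → sum (P ++ x ∷ []) ≡ sum P + x
sum-snoc P x = trans (sum-++ P (x ∷ [])) (cong (sum P +_) (+-identityʳ x))

length-snoc : ∀ (P : List ℕ) x → length (P ++ x ∷ []) ≡ suc (length P)
length-snoc P x = trans (length-++ P) (+-comm (length P) 1)

length-≤-snoc : ∀ {α} P x → α ≤ length P → α ≤ length (P ++ x ∷ [])
length-≤-snoc P x α≤P = subst (_ ≤_) (sym (length-snoc P x)) (m≤n⇒m≤1+n α≤P)

appendSum : ∀ {α} P x {v} → α ≤ length P → Removable P v → InSigma α (P ++ x ∷ []) (sum P + x ∸ v)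
appendSum P x α≤P (inj₁ refl) =
  P ++ x ∷ [] , ⊆-refl , length-≤-snoc P x α≤P , sum-snoc P x
appendSum P x {v} α≤P (inj₂ v∈P) with remove P v∈P
... | P′ , P′⊆P , len , total =
  P′ ++ x ∷ [] , ++⁺ P′⊆P ⊆-refl , subst (_ ≤_) (trans len (sym (length-snoc P′ x))) α≤P , sumEq
  where
  sumEq : sum (P′ ++ x ∷ []) ≡ sum P + x ∸ v
  sumEq = begin
    sum (P′ ++ x ∷ [])  ≡⟨ sum-snoc P′ x ⟩
    sum P′ + x          ≡⟨ m+n∸n≡m (sum P′ + x) v ⟨
    sum P′ + x + v ∸ v  ≡⟨ cong (_∸ v) (trans (+-assoc (sum P′) x v) (trans (cong (sum P′ +_) (+-comm x v)) (sym (+-assoc (sum P′) v x)))) ⟩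
    sum P′ + v + x ∸ v  ≡⟨ cong (λ t → t + x ∸ v) total ⟩
    sum P + x ∸ v       ∎

-- Stepwise Q P L C: each entry x of L, labelled by the matching entry w of C,
-- satisfies Q P′ x w, where P′ is P followed by the entries of L before x.
Stepwise : (List ℕ → ℕ → ℕ → Set) → List ℕ → List ℕ → List ℕ → Set
Stepwise Q P []      []      = ⊤
Stepwise Q P (x ∷ L) (w ∷ C) = Q P x w × Stepwise Q (P ++ x ∷ []) L C
Stepwise Q P []      (_ ∷ _) = ⊥
Stepwise Q P (_ ∷ _) []      = ⊥

stepwise-drop : ∀ {Q} n P L C → Stepwise Q P L C → Stepwise Q (P ++ take n L) (drop n L) (drop n C)
stepwise-drop {Q} zero P L C steps = subst (λ R → Stepwise Q R L C) (sym (++-identityʳ P)) steps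
stepwise-drop (suc n) P []      []      tt          = tt
stepwise-drop {Q} (suc n) P (x ∷ L) (w ∷ C) (_ , steps) =
  subst (λ R → Stepwise Q R (drop n L) (drop n C)) (++-assoc P (x ∷ []) (take n L))
    (stepwise-drop n (P ++ x ∷ []) L C steps)

∈-replicate : ∀ {n} (x : ℕ) → 1 ≤ n → x ∈ replicate n x
∈-replicate x (s≤s _) = here refl

stepwise-replicate : ∀ {Q} n P x w L C → (∀ P′ → P ⊆ₘ P′ → Q P′ x w) →
  Stepwise Q (P ++ replicate n x) L C → Stepwise Q P (replicate n x ++ L) (replicate n w ++ C)
stepwise-replicate {Q} zero P x w L C q steps = subst (λ R → Stepwise Q R L C) (++-identityʳ P) steps
stepwise-replicate {Q} (suc n) P x w L C q steps =
  q P id ,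
  stepwise-replicate n (P ++ x ∷ []) x w L C (λ P′ P⊆P′ → q P′ (P⊆P′ ∘ ∈-++⁺ˡ))
    (subst (λ R → Stepwise Q R L C) (sym (++-assoc P (x ∷ []) (replicate n x))) steps)

stepwiseBlocks : ∀ {Q} k (a c r : Fin k → ℕ) P → (∀ i → 1 ≤ r i) →
  (∀ i P′ → P ⊆ₘ P′ → (∀ j → toℕ j < toℕ i → a j ∈ P′) → Q P′ (a i) (c i)) →
  Stepwise Q P (seqOf k a r) (seqOf k c r)
stepwiseBlocks zero a c r P r≥1 q = tt
stepwiseBlocks {Q} (suc k) a c r P r≥1 q =
  subst₂ (Stepwise Q P) (sym (seqOf-suc k a r)) (sym (seqOf-suc k c r))
    (stepwise-replicate (r fz) P (a fz) (c fz) _ _ (λ P′ P⊆P′ → q fz P′ P⊆P′ (λ _ ()))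
      (stepwiseBlocks k (a ∘ fs) (c ∘ fs) (r ∘ fs) P₁ (r≥1 ∘ fs) q′))
  where
  P₁ : List ℕ
  P₁ = P ++ replicate (r fz) (a fz)
  q′ : ∀ i P′ → P₁ ⊆ₘ P′ → (∀ j → toℕ j < toℕ i → a (fs j) ∈ P′) → Q P′ (a (fs i)) (c (fs i))
  q′ i P′ P₁⊆P′ earlier = q (fs i) P′ (P₁⊆P′ ∘ ∈-++⁺ˡ) earlier′
    where
    earlier′ : ∀ j → toℕ j < suc (toℕ i) → a j ∈ P′
    earlier′ fz     _        = P₁⊆P′ (∈-++⁺ʳ P (∈-replicate (a fz) (r≥1 fz)))
    earlier′ (fs j) (s≤s j<i) = earlier j j<i

-- Good P x w: there are w distinct removable values of P below x.  Appending x
-- then creates w new sums sum P + x ∸ v, each larger than sum P.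
Good : List ℕ → ℕ → ℕ → Set
Good P x w = Σ (List ℕ) λ W → Unique W × All (_< x) W × All (Removable P) W × length W ≡ w

SumList : ℕ → List ℕ → List ℕ → Set
SumList α P S = Unique S × All (InSigma α P) S × All (_≤ sum P) S

unique-map-on : ∀ {Q : ℕ → Set} (f : ℕ → ℕ) → (∀ {u v} → Q u → Q v → f u ≡ f v → u ≡ v) →
  ∀ {W} → All Q W → Unique W → Unique (map f W)
unique-map-on f inj []         []         = []
unique-map-on f inj (qv ∷ qW) (v∉W ∷ uW) =
  all-map⁺ (all-zipWith (λ (v≢u , qu) e → v≢u (inj qv qu e)) (v∉W , qW)) ∷ unique-map-on f inj qW uW

extendSums : ∀ {α P x w S} → α ≤ length P → Good P x w → SumList α P S →
  Σ (List ℕ) λ S′ → SumList α (P ++ x ∷ []) S′ × length S′ ≡ length S + w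
extendSums {α} {P} {x} {w} {S} α≤P (W , uW , W<x , remW , lenW) (uS , sumsS , S≤P) =
  S ++ new ,
  (unique-++⁺ uS (unique-map-on next next-injective W<x uW) disjoint ,
   all-++⁺ (all-map (InSigma-mono (++⁺ʳ (x ∷ []) ⊆-refl)) sumsS) (all-map⁺ (all-map (appendSum P x α≤P) remW)) ,
   subst (λ t → All (_≤ t) (S ++ new)) (sym (sum-snoc P x))
     (all-++⁺ (all-map (λ s≤K → ≤-trans s≤K (m≤m+n K x)) S≤P) (all-map⁺ (all-map (λ {v} _ → m∸n≤m (K + x) v) W<x)))) ,
  trans (length-++ S) (cong (length S +_) (trans (length-map next W) lenW))
  where
  K : ℕ
  K = sum P
  next : ℕ → ℕ
  next v = K + x ∸ v
  new : List ℕ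
  new = map next W
  next-injective : ∀ {u v} → u < x → v < x → next u ≡ next v → u ≡ v
  next-injective u<x v<x = ∸-cancelˡ-≡ (≤-trans (<⇒≤ u<x) (m≤n+m x K)) (≤-trans (<⇒≤ v<x) (m≤n+m x K))
  next-above : ∀ {v} → v < x → K < next v
  next-above {v} v<x = subst (K <_) (sym (+-∸-assoc K (<⇒≤ v<x)))
    (subst (_< K + (x ∸ v)) (+-identityʳ K) (+-monoʳ-< K (m<n⇒0<n∸m v<x)))
  disjoint : ∀ {s} → ¬ (s ∈ S × s ∈ new)
  disjoint (s∈S , s∈new) = <⇒≱ (lookup (all-map⁺ {P = K <_} (all-map next-above W<x)) s∈new) (lookup S≤P s∈S)

countSums : ∀ {α} P L C {S} → α ≤ length P → Stepwise Good P L C → SumList α P S →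
  Σ (List ℕ) λ S′ → SumList α (P ++ L) S′ × length S′ ≡ length S + sum C
countSums P []      []      {S} α≤P tt       sums =
  S , subst (λ Q → SumList _ Q S) (sym (++-identityʳ P)) sums , sym (+-identityʳ (length S))
countSums P (x ∷ L) (w ∷ C) {S} α≤P (good , rest) sums with extendSums α≤P good sums
... | S₁ , sums₁ , len₁ with countSums (P ++ x ∷ []) L C (length-≤-snoc P x α≤P) rest sums₁
...   | S′ , sums′ , len′ =
  S′ , subst (λ Q → SumList _ Q S′) (++-assoc P (x ∷ []) L) sums′ ,
  trans len′ (trans (cong (_+ sum C) len₁) (+-assoc (length S) w (sum C)))

Dense : List ℕ → ℕ → Set
Dense P x = ∀ u → u < x → Removable P u

Covers : ℕ → List ℕ → ℕ → Set
Covers α P lo = ∀ s → lo ≤ s → s ≤ sum P → InSigma α P s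

extendCover : ∀ {α lo} P x → α ≤ length P → Dense P x → Covers α P lo → Covers α (P ++ x ∷ []) lo
extendCover P x α≤P dense cover s lo≤s s≤ with s ≤? sum P
... | yes s≤K = InSigma-mono (++⁺ʳ (x ∷ []) ⊆-refl) (cover s lo≤s s≤K)
... | no s≰K  = subst (InSigma _ (P ++ x ∷ [])) (m∸[m∸n]≡n s≤K+x) (appendSum P x α≤P (dense (sum P + x ∸ s) gap<x))
  where
  s≤K+x : s ≤ sum P + x
  s≤K+x = subst (s ≤_) (sum-snoc P x) s≤
  gap<x : sum P + x ∸ s < x
  gap<x = subst (sum P + x ∸ s <_) (m+n∸m≡n (sum P) x) (∸-monoʳ-< (≰⇒> s≰K) s≤K+x)

coverSums : ∀ {α lo} P L C → α ≤ length P → Stepwise (λ P x _ → Dense P x) P L C →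
  Covers α P lo → Covers α (P ++ L) lo
coverSums P []      []      α≤P tt              cover = subst (λ Q → Covers _ Q _) (sym (++-identityʳ P)) cover
coverSums P (x ∷ L) (w ∷ C) α≤P (dense , rest) cover =
  subst (λ Q → Covers _ Q _) (++-assoc P (x ∷ []) L)
    (coverSums (P ++ x ∷ []) L C (length-≤-snoc P x α≤P) rest (extendCover P x α≤P dense cover))

strictMono-injective : ∀ {k} {a : Fin k → ℕ} → (∀ i j → toℕ i < toℕ j → a i < a j) →
  ∀ {i j} → a i ≡ a j → i ≡ j
strictMono-injective mono {i} {j} ai≡aj with <-cmp (toℕ i) (toℕ j)
... | tri< i<j _ _ = ⊥-elim (<⇒≢ (mono i j i<j) ai≡aj)
... | tri≈ _ i≡j _ = toℕ-injective i≡j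
... | tri> _ _ j<i = ⊥-elim (<⇒≢ (mono j i j<i) (sym ai≡aj))

inject-< : ∀ {k} {i : Fin k} (j : Fin (toℕ i)) → toℕ (inject j) < toℕ i
inject-< j = subst (_< _) (sym (toℕ-inject j)) (toℕ<n j)

inject-injective : ∀ {k} {i : Fin k} {j j′ : Fin (toℕ i)} → inject j ≡ inject j′ → j ≡ j′
inject-injective {j = j} {j′} e = toℕ-injective (trans (sym (toℕ-inject j)) (trans (cong toℕ e) (toℕ-inject j′)))

-- In an admissible sequence, block i (0-based) has the i+1 removable values
-- 0, a_j (j < i) below a_i.
goodBlock : ∀ {k} {a : Fin k → ℕ} → Admissible k a → ∀ i P′ → (∀ j → toℕ j < toℕ i → a j ∈ P′) →
  Good P′ (a i) (suc (toℕ i))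
goodBlock {a = a} (pos , mono) i P′ earlier =
  0 ∷ V ,
  all-tabulate⁺ (λ j → <⇒≢ (pos (inject j))) ∷ unique-tabulate⁺ (inject-injective ∘ strictMono-injective mono) ,
  pos i ∷ all-tabulate⁺ (λ j → mono (inject j) i (inject-< j)) ,
  inj₁ refl ∷ all-tabulate⁺ (λ j → inj₂ (earlier (inject j) (inject-< j))) ,
  cong suc (length-tabulate (a ∘ inject))
  where
  V : List ℕ
  V = tabulate (a ∘ inject {i = i})

-- The extremal sequence a_i = i, in the paper's 1-based indexing.
paperIndex : ∀ {k} → Fin k → ℕ
paperIndex i = suc (toℕ i)

denseBlock : ∀ {k} (i : Fin k) P′ → (∀ j → toℕ j < toℕ i → paperIndex j ∈ P′) → Dense P′ (paperIndex i)
denseBlock i P′ earlier zero    _         = inj₁ refl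
denseBlock i P′ earlier (suc u) (s≤s u<i) =
  inj₂ (subst (_∈ P′) (cong suc (trans (toℕ-inject j) (toℕ-fromℕ< u<i))) (earlier (inject j) (inject-< j)))
  where
  j : Fin (toℕ i)
  j = fromℕ< u<i

allPairs-replicate : ∀ n (x : ℕ) → AllPairs _≤_ (replicate n x)
allPairs-replicate zero    x = []
allPairs-replicate (suc n) x = all-replicate⁺ n ≤-refl ∷ allPairs-replicate n x

seqOf-sorted : ∀ k (a r : Fin k → ℕ) → (∀ i j → toℕ i < toℕ j → a i < a j) → AllPairs _≤_ (seqOf k a r)
seqOf-sorted k a r mono = subst (AllPairs _≤_) (cong concat (sym (map-tabulate id block)))
  (allPairs-concat⁺ (all-tabulate⁺ (λ i → allPairs-replicate (r i) (a i)))
    (allPairs-tabulate⁺ (λ {i} {j} i<j → all-replicate⁺ (r i) (all-replicate⁺ (r j) (<⇒≤ (mono i j i<j))))))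
  where
  block : Fin k → List ℕ
  block i = replicate (r i) (a i)

take-shift : ∀ y L α → All (y ≤_) L → AllPairs _≤_ L → α ≤ length L → sum (take α (y ∷ L)) ≤ sum (take α L)
take-shift y L       zero    _         _            _         = z≤n
take-shift y (z ∷ L) (suc α) (y≤z ∷ _) (z≤L ∷ sorted) (s≤s α≤L) = +-mono-≤ y≤z (take-shift z L α z≤L sorted α≤L)

minSum : ∀ L B α → AllPairs _≤_ L → B ⊆ L → α ≤ length B → sum (take α L) ≤ sum B
minSum []      []      zero _                  []        _         = z≤n
minSum (y ∷ L) B       α    (y≤L ∷ sorted) (.y ∷ʳ B⊆L) α≤B =
  ≤-trans (take-shift y L α y≤L sorted (≤-trans α≤B (length-mono-≤ B⊆L))) (minSum L B α sorted B⊆L α≤B)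
minSum (y ∷ L) (.y ∷ B) zero    _              (refl ∷ B⊆L) _         = z≤n
minSum (y ∷ L) (.y ∷ B) (suc α) (_ ∷ sorted)   (refl ∷ B⊆L) (s≤s α≤B) = +-monoʳ-≤ y (minSum L B α sorted B⊆L α≤B)

length-take-≤ : ∀ {α} (L : List ℕ) → α ≤ length L → length (take α L) ≡ α
length-take-≤ {α} L α≤L = trans (length-take α L) (m≤n⇒m⊓n≡m α≤L)

prefixSum : ∀ {α} (L : List ℕ) → α ≤ length L → InSigma α (take α L) (sum (take α L))
prefixSum L α≤L = take _ L , ⊆-refl , ≤-reflexive (sym (length-take-≤ L α≤L)) , refl

lowerCount : ∀ k (a r : Fin k → ℕ) α → Admissible k a → (∀ i → 1 ≤ r i) → α < psum r k →
  AtLeast (InSigma α (seqOf k a r)) (suc (sum (drop α (seqOf k paperIndex r))))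
lowerCount k a r α adm r≥1 α<total =
  let S , (unique , sums , _) , len = countSums (take α L) (drop α L) (drop α C) α≤prefix steps start
  in S , unique , subst (λ Q → All (InSigma α Q) S) (take++drop≡id α L) sums , ≤-reflexive (sym len)
  where
  L C : List ℕ
  L = seqOf k a r
  C = seqOf k paperIndex r
  α≤L : α ≤ length L
  α≤L = subst (α ≤_) (sym (length-seqOf k a r)) (<⇒≤ α<total)
  α≤prefix : α ≤ length (take α L)
  α≤prefix = ≤-reflexive (sym (length-take-≤ L α≤L))
  steps : Stepwise Good (take α L) (drop α L) (drop α C)
  steps = stepwise-drop α [] L C (stepwiseBlocks k a paperIndex r [] r≥1 (λ i P′ _ → goodBlock adm i P′))
  start : SumList α (take α L) (sum (take α L) ∷ [])
  start = [] ∷ [] , prefixSum L α≤L ∷ [] , ≤-refl ∷ []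

exactCount : ∀ k (r : Fin k → ℕ) α → (∀ i → 1 ≤ r i) → α < psum r k →
  Exactly (InSigma α (seqOf k paperIndex r)) (suc (sum (drop α (seqOf k paperIndex r))))
exactCount k r α r≥1 α<total =
  applyUpTo (lo +_) n ,
  unique-applyUpTo⁺₁ (lo +_) n (λ i<j _ e → <⇒≢ i<j (+-cancelˡ-≡ lo _ _ e)) ,
  all-applyUpTo⁺₁ (lo +_) n (λ {i} i<n → cover (lo + i) (m≤m+n lo i) (subst (lo + i ≤_) (sym total) (+-monoʳ-≤ lo (s≤s⁻¹ i<n)))) ,
  complete ,
  length-applyUpTo (lo +_) n
  where
  L : List ℕ
  L = seqOf k paperIndex r
  lo n : ℕ
  lo = sum (take α L)
  n = suc (sum (drop α L))
  total : sum L ≡ lo + sum (drop α L)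
  total = trans (cong sum (sym (take++drop≡id α L))) (sum-++ (take α L) (drop α L))
  α≤L : α ≤ length L
  α≤L = subst (α ≤_) (sym (length-seqOf k paperIndex r)) (<⇒≤ α<total)
  steps : Stepwise (λ P x _ → Dense P x) (take α L) (drop α L) (drop α L)
  steps = stepwise-drop α [] L L (stepwiseBlocks k paperIndex paperIndex r [] r≥1 (λ i P′ _ → denseBlock i P′))
  start : Covers α (take α L) lo
  start s lo≤s s≤lo = subst (InSigma α (take α L)) (≤-antisym lo≤s s≤lo) (prefixSum L α≤L)
  cover : Covers α L lo
  cover = subst (λ Q → Covers α Q lo) (take++drop≡id α L)
    (coverSums (take α L) (drop α L) (drop α L) (≤-reflexive (sym (length-take-≤ L α≤L))) steps start)
  complete : ∀ s → InSigma α L s → s ∈ applyUpTo (lo +_) n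
  complete s (B , B⊆L , α≤B , refl) = subst (_∈ applyUpTo (lo +_) n) (m+[n∸m]≡n lo≤s) (∈-applyUpTo⁺ (lo +_) gap<n)
    where
    lo≤s : lo ≤ sum B
    lo≤s = minSum L B α (seqOf-sorted k paperIndex r (λ _ _ → s≤s)) B⊆L α≤B
    gap<n : sum B ∸ lo < n
    gap<n = s≤s (m≤n+o⇒m∸n≤o (sum B) lo (subst (sum B ≤_) total (sum-mono-⊆ B⊆L)))

theorem3p1 : (k : ℕ) → 1 ≤ k → (r : Fin k → ℕ) → (∀ i → 1 ≤ r i) →
    (α : ℕ) → α < psum r k →
    Σ ℕ λ m → (1 ≤ m × m ≤ k × psum r (m ∸ 1) ≤ α × α < psum r m) ×
      ((∀ (a : Fin k → ℕ) → Admissible k a →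
          AtLeast (InSigma α (seqOf k a r))
            ((psum (weighted r) k ∸ psum (weighted r) m) + m * (psum r m ∸ α) + 1)) ×
       Σ (Fin k → ℕ) λ a → Admissible k a ×
          Exactly (InSigma α (seqOf k a r))
            ((psum (weighted r) k ∸ psum (weighted r) m) + m * (psum r m ∸ α) + 1))
theorem3p1 k _ r r≥1 α α<total with locateBlock k r α α<total
... | m , block =
  m , block ,
  (λ a adm → subst (AtLeast _) size (lowerCount k a r α adm r≥1 α<total)) ,
  paperIndex , ((λ _ → s≤s z≤n) , λ _ _ → s≤s) ,
  subst (Exactly _) size (exactCount k r α r≥1 α<total)
  where
  bound : ℕ
  bound = (psum (weighted r) k ∸ psum (weighted r) m) + m * (psum r m ∸ α)
  size : suc (sum (drop α (seqOf k paperIndex r))) ≡ bound + 1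
  size = trans (cong suc (tailSum k r paperIndex 0 (λ _ → refl) α m block)) (+-comm 1 bound)
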